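{- Let $n\ge 2$. For every integer $i\ge 0$ with $i>(n-4)(n-1)$, the period map $\mathrm{per}$ restricts to a bijection from $\mathcal{L}_i$ onto $\mathcal{L}_{i+n-1}$.
   Context: Let $n\ge 2$ be an integer. A partition is a sequence $\Lambda=(\lambda_t)_{t\ge 1}$ of non-negative integers with finite support; $\mathrm{wt}(\Lambda)=\sum_t t\lambda_t$; $x^\Lambda=\prod_t x_t^{\lambda_t}$ (monomial in commuting indeterminates), $\deg(x^\Lambda)=\sum_t\lambda_t$. $\mathrm{Part}(j)$ is the set of partitions with $\lambda_t=0$ for $t>j$; $\partial_k$ is the partial derivative with respect to $x_k$. Let $\mathcal{B}=\{x^\Lambda\partial_k:1\le k\le n,\ \Lambda\in\mathrm{Part}(k-1)\}$. For an integer $i\ge -1$ let $r_i\in\{1,\dots,n-1\}$ with $i\equiv r_i\pmod{n-1}$ and $h_i=\lfloor (i-1)/(n-1)\rfloor+1$, so $i=(h_i-1)(n-1)+r_i$. For $x^\Lambda\partial_k\in\mathcal{B}$ define $\mathrm{WD}(x^\Lambda\partial_k)=\mathrm{wt}(\Lambda)-\deg(x^\Lambda)+n-k$ and $\mathrm{lev}_i(x^\Lambda\partial_k)=h_i\,\mathrm{WD}(x^\Lambda\partial_k)+\deg(x^\Lambda)-1$. For $i\ge -1$ let $\mathcal{N}_i=\{b\in\mathcal{B}: \mathrm{lev}_j(b)\le j \text{ for some integer } j \text{ with } -1\le j\le i\}$, and for $i\ge 0$ let $\mathcal{L}_i=\mathcal{N}_i\setminus\mathcal{N}_{i-1}$.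 The period map is $\mathrm{per}(x^\Lambda\partial_k)=x_1^{\,n-1-\mathrm{WD}(x^\Lambda\partial_k)}x^\Lambda\partial_k$, defined for basis elements with $\mathrm{WD}(x^\Lambda\partial_k)\le n-1$ (this includes all elements of every $\mathcal{L}_i$). -}

module Defs where

open import Data.Nat as ℕ using (ℕ; zero; suc)
open import Data.Fin using (Fin; toℕ)
import Data.Fin as F
open import Data.Vec using (Vec; []; _∷_; sum)
open import Data.Product using (Σ; ∃; _×_; _,_)
open import Data.Integer as ℤ using (ℤ; +_; _/ℕ_)
open import Relation.Nullary using (¬_)

-- A basis element x^Λ ∂_k of 𝓑 (for a fixed n) is a pair (k', Λ) with
-- k' : Fin n encoding k = toℕ k' + 1 ∈ {1,…,n}, and Λ ∈ Part(k-1) given by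
-- the vector (λ_1, …, λ_{k-1}) of length k-1 = toℕ k'.
Basis : ℕ → Set
Basis n = Σ (Fin n) (λ k′ → Vec ℕ (toℕ k′))

kOf : ∀ {n} → Basis n → ℕ
kOf (k′ , _) = suc (toℕ k′)

wtFrom : ∀ {m} → ℕ → Vec ℕ m → ℕ
wtFrom s []       = 0
wtFrom s (x ∷ xs) = s ℕ.* x ℕ.+ wtFrom (suc s) xs

wt : ∀ {m} → Vec ℕ m → ℕ
wt = wtFrom 1

deg : ∀ {m} → Vec ℕ m → ℕ
deg = sum

-- WD(x^Λ ∂_k) = wt(Λ) - deg(x^Λ) + n - k   (all terms exact: wt ≥ deg, k ≤ n)
WD : ∀ {n} → Basis n → ℕ
WD {n} b@(k′ , Λ) = (wt Λ ℕ.∸ deg Λ) ℕ.+ (n ℕ.∸ kOf b)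

-- h_j = ⌊(j-1)/(n-1)⌋ + 1 (floor division). The divisor n-1 is written
-- suc (n ∸ 2), which equals n-1 under the standing assumption n ≥ 2.
h : ℕ → ℤ → ℤ
h n j = ((j ℤ.- ℤ.+ 1) /ℕ suc (n ℕ.∸ 2)) ℤ.+ ℤ.+ 1

lev : ∀ {n} → ℤ → Basis n → ℤ
lev {n} j b@(k′ , Λ) = h n j ℤ.* ℤ.+ (WD b) ℤ.+ ℤ.+ (deg Λ) ℤ.- ℤ.+ 1

𝓝 : ∀ {n} → ℤ → Basis n → Set
𝓝 i b = ∃ λ (j : ℤ) → (ℤ.-1ℤ ℤ.≤ j) × (j ℤ.≤ i) × (lev j b ℤ.≤ j)

𝓛 : ∀ {n} → ℕ → Basis n → Set
𝓛 i b = 𝓝 (+ i) b × ¬ 𝓝 (+ i ℤ.- ℤ.+ 1) b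

-- per(x^Λ ∂_k) = x_1^{n-1-WD} x^Λ ∂_k : add n-1-WD to λ_1.
-- For k = 1 (Λ empty) one has WD = n-1, so the exponent is 0 and per is the identity.
-- (Truncated subtraction only matters outside the domain WD ≤ n-1.)
per : ∀ {n} → Basis n → Basis n
per {n} b@(F.zero , Λ) = b
per {n} b@(F.suc k″ , l₁ ∷ Λ) = F.suc k″ , ((n ℕ.∸ 1 ℕ.∸ WD b) ℕ.+ l₁) ∷ Λ

module Submission where

-- Write N = n - 1. Since h_{j+N} = h_j + 1 and per raises deg by N - WD while fixing WD, one has
-- lev_{j+N}(per b) = lev_j(b) + N whenever WD(b) ≤ N. So per carries the first level crossing of
-- b at j to a crossing of per b at j + N, and back, provided per b has no crossing in the initial
-- window -1 ≤ j ≤ N - 2, where the shifted index would fall below -1. Every b ∈ 𝓛_i has WD(b) ≤ N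
-- and deg(per b) ≥ 2, which rules out crossings in that window. Conversely, an element c ∈ 𝓛_{i+N}
-- has WD(c) < N, and the bound on i puts the index (n-3)N in the range where c has no crossing;
-- at that index this forces deg(c) ≥ N, which is exactly what is needed for x_1^{N - WD(c)} to
-- divide x^Λ, i.e. for c to lie in the image of per.

open import Data.Nat as ℕ using (ℕ; zero; suc; z≤n; s≤s)
import Data.Nat.Properties as ℕP
import Data.Nat.Tactic.RingSolver as ℕ-Solver
open import Data.Integer as ℤ using (ℤ; +_; 0ℤ; -1ℤ; 1ℤ; _/ℕ_)
import Data.Integer.Properties as ℤP
open import Data.Integer.DivMod using ([n/ℕd]*d≤n; n<s[n/ℕd]*d)
open import Data.Integer.Tactic.RingSolver using (solve-∀)
open import Data.Fin as F using (Fin; toℕ)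
open import Data.Fin.Properties using (toℕ≤pred[n])
open import Data.Vec using (Vec; []; _∷_; sum)
open import Data.Product using (∃; _×_; _,_; proj₂)
open import Data.Empty using (⊥; ⊥-elim)
open import Relation.Binary.Definitions using (tri<; tri≈; tri>)
open import Relation.Binary.PropositionalEquality
open import Relation.Nullary using (¬_; yes; no)
open import Defs

module _ where
  open import Data.Nat using (_+_; _*_; _∸_; _≤_)

  wtFrom-suc : ∀ s {len} (v : Vec ℕ len) → wtFrom (suc s) v ≡ wtFrom s v + sum v
  wtFrom-suc s []      = refl
  wtFrom-suc s (x ∷ v) = begin
    suc s * x + wtFrom (suc (suc s)) v       ≡⟨ cong (λ w → suc s * x + w) (wtFrom-suc (suc s) v) ⟩
    suc s * x + (wtFrom (suc s) v + sum v)   ≡⟨ regroup s x (wtFrom (suc s) v) (sum v) ⟩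
    s * x + wtFrom (suc s) v + (x + sum v)   ∎
    where
    open ≡-Reasoning
    regroup : ∀ s x w t → suc s * x + (w + t) ≡ s * x + w + (x + t)
    regroup = ℕ-Solver.solve-∀

  wtFrom≤[s+len]*sum : ∀ s {len} (v : Vec ℕ len) → wtFrom (suc s) v ≤ (s + len) * sum v
  wtFrom≤[s+len]*sum s []                = z≤n
  wtFrom≤[s+len]*sum s {suc len} (x ∷ v) = begin
    suc s * x + wtFrom (suc (suc s)) v        ≤⟨ ℕP.+-mono-≤ (ℕP.*-monoˡ-≤ x (s≤s (ℕP.m≤m+n s len)))
                                                             (wtFrom≤[s+len]*sum (suc s) v) ⟩
    suc (s + len) * x + suc (s + len) * sum v ≡⟨ ℕP.*-distribˡ-+ (suc (s + len)) x (sum v) ⟨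
    suc (s + len) * (x + sum v)               ≡⟨ cong (_* (x + sum v)) (ℕP.+-suc s len) ⟨
    (s + suc len) * (x + sum v)               ∎
    where open ℕP.≤-Reasoning

  sum≤wt : ∀ {len} (v : Vec ℕ len) → sum v ≤ wt v
  sum≤wt v = subst (sum v ≤_) (sym (wtFrom-suc 0 v)) (ℕP.m≤n+m (sum v) (wtFrom 0 v))

  wt-∷∸deg : ∀ {len} l (Λ : Vec ℕ len) → wt (l ∷ Λ) ∸ deg (l ∷ Λ) ≡ wt Λ
  wt-∷∸deg l Λ = begin
    1 * l + wtFrom 2 Λ ∸ (l + sum Λ)       ≡⟨ cong (λ w → 1 * l + w ∸ (l + sum Λ)) (wtFrom-suc 1 Λ) ⟩
    1 * l + (wt Λ + sum Λ) ∸ (l + sum Λ)   ≡⟨ cong (_∸ (l + sum Λ)) (regroup l (wt Λ) (sum Λ)) ⟩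
    l + sum Λ + wt Λ ∸ (l + sum Λ)         ≡⟨ ℕP.m+n∸m≡n (l + sum Λ) (wt Λ) ⟩
    wt Λ                                   ∎
    where
    open ≡-Reasoning
    regroup : ∀ l w t → 1 * l + (w + t) ≡ l + t + w
    regroup = ℕ-Solver.solve-∀

  degree : ∀ {n} → Basis n → ℕ
  degree (_ , Λ) = deg Λ

  WD-∷ : ∀ {n} (k : Fin n) l (Λ : Vec ℕ (toℕ k)) → WD (F.suc k , l ∷ Λ) ≡ wt Λ + (n ∸ suc (toℕ k))
  WD-∷ k l Λ = cong (_+ _) (wt-∷∸deg l Λ)

  WD-ignores-λ₁ : ∀ {n} (k : Fin n) l l′ (Λ : Vec ℕ (toℕ k)) →
                  WD (F.suc k , l ∷ Λ) ≡ WD (F.suc k , l′ ∷ Λ)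
  WD-ignores-λ₁ k l l′ Λ = trans (WD-∷ k l Λ) (sym (WD-∷ k l′ Λ))

  WD-per : ∀ {n} (b : Basis n) → WD (per b) ≡ WD b
  WD-per     (F.zero  , [])      = refl
  WD-per {n} b@(F.suc k , l ∷ Λ) = WD-ignores-λ₁ k (n ∸ 1 ∸ WD b + l) l Λ

  degree-per : ∀ {n} (b : Basis n) → degree (per b) ≡ degree b + (n ∸ 1 ∸ WD b)
  degree-per {n} (F.zero  , [])    = sym (ℕP.n∸n≡0 (n ∸ 1))
  degree-per     (F.suc k , l ∷ Λ) = regroup _ l (sum Λ)
    where
    regroup : ∀ D l t → D + l + t ≡ l + t + D
    regroup = ℕ-Solver.solve-∀

  unper : ∀ {n} → Basis n → Basis n
  unper     b@(F.zero  , _)     = b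
  unper {n} c@(F.suc k , a ∷ Λ) = F.suc k , (a ∸ (n ∸ 1 ∸ WD c)) ∷ Λ

  unper-per : ∀ {n} (b : Basis n) → unper (per b) ≡ b
  unper-per     (F.zero  , [])      = refl
  unper-per {n} b@(F.suc k , l ∷ Λ) = cong (λ x → F.suc k , x ∷ Λ) (begin
    D + l ∸ (n ∸ 1 ∸ WD (per b))   ≡⟨ cong (λ w → D + l ∸ (n ∸ 1 ∸ w)) (WD-per b) ⟩
    D + l ∸ D                      ≡⟨ ℕP.m+n∸m≡n D l ⟩
    l                              ∎)
    where
    open ≡-Reasoning
    D = n ∸ 1 ∸ WD b

  per-injective : ∀ {n} {b b′ : Basis n} → per b ≡ per b′ → b ≡ b′
  per-injective {b = b} {b′} eq = begin
    b               ≡⟨ unper-per b ⟨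
    unper (per b)   ≡⟨ cong unper eq ⟩
    unper (per b′)  ≡⟨ unper-per b′ ⟩
    b′              ∎
    where open ≡-Reasoning

  -- Since deg(x^Λ) - λ₁ ≤ WD(c), the hypothesis gives λ₁ ≥ n - 1 - WD(c).
  per-unper : ∀ {n} (c : Basis n) → n ∸ 1 ≤ degree c → per (unper c) ≡ c
  per-unper     (F.zero  , [])      _       = refl
  per-unper {n} c@(F.suc k , a ∷ Λ) n-1≤deg = cong (λ x → F.suc k , x ∷ Λ) (begin
    n ∸ 1 ∸ WD (unper c) + (a ∸ D)   ≡⟨ cong (λ w → n ∸ 1 ∸ w + (a ∸ D)) (WD-ignores-λ₁ k (a ∸ D) a Λ) ⟩
    D + (a ∸ D)                      ≡⟨ ℕP.m+[n∸m]≡n D≤a ⟩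
    a                                ∎)
    where
    open ≡-Reasoning
    D = n ∸ 1 ∸ WD c
    sumΛ≤WD : sum Λ ≤ WD c
    sumΛ≤WD = subst (sum Λ ≤_) (sym (WD-∷ k a Λ)) (ℕP.≤-trans (sum≤wt Λ) (ℕP.m≤m+n (wt Λ) _))
    D≤a : D ≤ a
    D≤a = ℕP.m≤n+o⇒m∸n≤o (n ∸ 1) (WD c) (ℕP.≤-trans n-1≤deg
            (subst (a + sum Λ ≤_) (ℕP.+-comm a (WD c)) (ℕP.+-monoʳ-≤ a sumΛ≤WD)))

  degree-one⇒WD≤ : ∀ {m} (b : Basis (suc (suc m))) → degree b ≡ 1 → WD b ≤ m
  degree-one⇒WD≤     (F.zero  , [])    ()
  degree-one⇒WD≤ {m} (F.suc k , l ∷ Λ) deg≡1 = begin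
    WD (F.suc k , l ∷ Λ)    ≡⟨ WD-∷ k l Λ ⟩
    wt Λ + (m ∸ t)          ≤⟨ ℕP.+-monoˡ-≤ (m ∸ t) wtΛ≤t ⟩
    t + (m ∸ t)             ≡⟨ ℕP.m+[n∸m]≡n (toℕ≤pred[n] k) ⟩
    m                       ∎
    where
    open ℕP.≤-Reasoning
    t = toℕ k
    sumΛ≤1 : sum Λ ≤ 1
    sumΛ≤1 = subst (sum Λ ≤_) deg≡1 (ℕP.m≤n+m (sum Λ) l)
    wtΛ≤t : wt Λ ≤ t
    wtΛ≤t = ℕP.≤-trans (wtFrom≤[s+len]*sum 0 Λ)
              (ℕP.≤-trans (ℕP.*-monoʳ-≤ t sumΛ≤1) (ℕP.≤-reflexive (ℕP.*-identityʳ t)))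

open import Data.Integer using (_+_; _-_; _*_; _≤_; _<_)

module _ (d : ℕ) .{{_ : ℕ.NonZero d}} where
  open ℤP.≤-Reasoning

  floor-bands-disjoint : ∀ {x p q} → p < q → x < ℤ.suc p * + d → q * + d ≤ x → ⊥
  floor-bands-disjoint {x} {p} {q} p<q x<band q*d≤x = ℤP.<-irrefl refl (begin-strict
    x               <⟨ x<band ⟩
    ℤ.suc p * + d   ≤⟨ ℤP.*-monoʳ-≤-nonNeg (+ d) (ℤP.i<j⇒suc[i]≤j p<q) ⟩
    q * + d         ≤⟨ q*d≤x ⟩
    x               ∎)

  /ℕ-unique : ∀ x {q} → q * + d ≤ x → x < ℤ.suc q * + d → x /ℕ d ≡ q
  /ℕ-unique x {q} lo hi with ℤP.<-cmp (x /ℕ d) q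
  ... | tri< p _ _ = ⊥-elim (floor-bands-disjoint p (n<s[n/ℕd]*d x d) lo)
  ... | tri≈ _ e _ = e
  ... | tri> _ _ p = ⊥-elim (floor-bands-disjoint p hi ([n/ℕd]*d≤n x d))

  /ℕ-shift : ∀ x → (x + + d) /ℕ d ≡ ℤ.suc (x /ℕ d)
  /ℕ-shift x = /ℕ-unique (x + + d) lo hi
    where
    q = x /ℕ d
    lo : ℤ.suc q * + d ≤ x + + d
    lo = begin
      ℤ.suc q * + d  ≡⟨ ℤP.suc-* q (+ d) ⟩
      + d + q * + d  ≤⟨ ℤP.+-monoʳ-≤ (+ d) ([n/ℕd]*d≤n x d) ⟩
      + d + x        ≡⟨ ℤP.+-comm (+ d) x ⟩
      x + + d        ∎
    hi : x + + d < ℤ.suc (ℤ.suc q) * + d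
    hi = begin-strict
      x + + d                ≡⟨ ℤP.+-comm x (+ d) ⟩
      + d + x                <⟨ ℤP.+-monoʳ-< (+ d) (n<s[n/ℕd]*d x d) ⟩
      + d + ℤ.suc q * + d    ≡⟨ ℤP.suc-* (ℤ.suc q) (+ d) ⟨
      ℤ.suc (ℤ.suc q) * + d  ∎

𝓝-mono : ∀ {n x y} {b : Basis n} → x ≤ y → 𝓝 x b → 𝓝 y b
𝓝-mono x≤y (j , -1≤j , j≤x , crossing) = j , -1≤j , ℤP.≤-trans j≤x x≤y , crossing

𝓛-crossing : ∀ {n} i (b : Basis n) → 𝓛 i b → lev (+ i) b ≤ + i
𝓛-crossing i b ((j , -1≤j , j≤i , crossing) , ¬𝓝) with j ℤP.≤? + i - 1ℤ
... | yes j≤i-1 = ⊥-elim (¬𝓝 (j , -1≤j , j≤i-1 , crossing))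
... | no  j≰i-1 = subst (λ x → lev x b ≤ x) (ℤP.≤-antisym j≤i i≤j) crossing
  where
  suc-pred : ∀ i → 1ℤ + (i - 1ℤ) ≡ i
  suc-pred = solve-∀
  i≤j : + i ≤ j
  i≤j = subst (_≤ j) (suc-pred (+ i)) (ℤP.i<j⇒suc[i]≤j (ℤP.≰⇒> j≰i-1))

module _ {n} (N : ℕ) {b c : Basis n} (lev-shift : ∀ j → lev (j + + N) c ≡ lev j b + + N) where
  open ℤP.≤-Reasoning

  𝓝-shift : ∀ {x} → 𝓝 x b → 𝓝 (x + + N) c
  𝓝-shift (j , -1≤j , j≤x , crossing) =
    j + + N , ℤP.≤-trans -1≤j (ℤP.i≤i+j j (+ N)) , ℤP.+-monoˡ-≤ (+ N) j≤x ,
    subst (_≤ j + + N) (sym (lev-shift j)) (ℤP.+-monoˡ-≤ (+ N) crossing)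

  -- A crossing of c at j ≤ N - 2 would correspond to one of b at j - N < -1.
  𝓝-unshift : ¬ 𝓝 (+ N - + 2) c → ∀ {x} → 𝓝 (x + + N) c → 𝓝 x b
  𝓝-unshift below {x} (j , -1≤j , j≤x+N , crossing) with j ℤP.≤? + N - + 2
  ... | yes j≤N-2 = ⊥-elim (below (j , -1≤j , j≤N-2 , crossing))
  ... | no  j≰N-2 = j - + N , -1≤j-N , j-N≤x , crossing′
    where
    +N-N : ∀ x N → x + N - N ≡ x
    +N-N = solve-∀
    -N+N : ∀ x N → x - N + N ≡ x
    -N+N = solve-∀
    window-edge : ∀ N → -1ℤ ≡ 1ℤ + (N - + 2) - N
    window-edge = solve-∀

    -1≤j-N : -1ℤ ≤ j - + N
    -1≤j-N = begin
      -1ℤ                     ≡⟨ window-edge (+ N) ⟩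
      1ℤ + (+ N - + 2) - + N  ≤⟨ ℤP.+-monoˡ-≤ (ℤ.- + N) (ℤP.i<j⇒suc[i]≤j (ℤP.≰⇒> j≰N-2)) ⟩
      j - + N                 ∎
    j-N≤x : j - + N ≤ x
    j-N≤x = begin
      j - + N          ≤⟨ ℤP.+-monoˡ-≤ (ℤ.- + N) j≤x+N ⟩
      x + + N - + N    ≡⟨ +N-N x (+ N) ⟩
      x                ∎
    crossing′ : lev (j - + N) b ≤ j - + N
    crossing′ = begin
      lev (j - + N) b                 ≡⟨ +N-N (lev (j - + N) b) (+ N) ⟨
      lev (j - + N) b + + N - + N     ≡⟨ cong (_- + N) (lev-shift (j - + N)) ⟨
      lev (j - + N + + N) c - + N     ≡⟨ cong (λ y → lev y c - + N) (-N+N j (+ N)) ⟩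
      lev j c - + N                   ≤⟨ ℤP.+-monoˡ-≤ (ℤ.- + N) crossing ⟩
      j - + N                         ∎

  private
    shift-pred : ∀ i → + (i ℕ.+ N) - 1ℤ ≡ + i - 1ℤ + + N
    shift-pred i = regroup (+ i) (+ N)
      where
      regroup : ∀ i N → i + N - 1ℤ ≡ i - 1ℤ + N
      regroup = solve-∀

  𝓛-shift : ∀ {i} → ¬ 𝓝 (+ N - + 2) c → 𝓛 i b → 𝓛 (i ℕ.+ N) c
  𝓛-shift {i} below (𝓝b , ¬𝓝b) =
    𝓝-shift 𝓝b , λ 𝓝c → ¬𝓝b (𝓝-unshift below (subst (λ x → 𝓝 x c) (shift-pred i) 𝓝c))

  𝓛-unshift : ∀ {i} → 𝓛 (i ℕ.+ N) c → 𝓛 i b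
  𝓛-unshift {i} (𝓝c , ¬𝓝c) =
    𝓝-unshift below 𝓝c , λ 𝓝b → ¬𝓝c (subst (λ x → 𝓝 x c) (sym (shift-pred i)) (𝓝-shift 𝓝b))
    where
    below : ¬ 𝓝 (+ N - + 2) c
    below 𝓝c′ = ¬𝓝c (𝓝-mono {b = c} (ℤP.+-mono-≤ (ℤ.+≤+ (ℕP.m≤n+m N i)) (ℤ.-≤- z≤n)) 𝓝c′)

-- N = n - 1 coincides with the divisor suc (n ∸ 2) in the definition of h.
module Period (m : ℕ) where

  n N : ℕ
  n = suc (suc m)
  N = suc m

  open ℤP.≤-Reasoning

  h-upper : ∀ j → j ≤ h n j * + N
  h-upper j = begin
    j                         ≡⟨ j≡suc[j-1] j ⟩
    ℤ.suc (j - 1ℤ)            ≤⟨ ℤP.i<j⇒suc[i]≤j (n<s[n/ℕd]*d (j - 1ℤ) N) ⟩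
    ℤ.suc q * + N             ≡⟨ cong (_* + N) (ℤP.+-comm 1ℤ q) ⟩
    h n j * + N               ∎
    where
    q = (j - 1ℤ) /ℕ N
    j≡suc[j-1] : ∀ j → j ≡ 1ℤ + (j - 1ℤ)
    j≡suc[j-1] = solve-∀

  h-nonpos : ∀ {j} → j ≤ 0ℤ → h n j ≤ 0ℤ
  h-nonpos {j} j≤0 = begin
    q + 1ℤ   ≡⟨ ℤP.+-comm q 1ℤ ⟩
    ℤ.suc q  ≤⟨ ℤP.i<j⇒suc[i]≤j q<0 ⟩
    0ℤ       ∎
    where
    q = (j - 1ℤ) /ℕ N
    q<0 : q < 0ℤ
    q<0 = ℤP.*-cancelʳ-<-nonNeg (+ N) (begin-strict
      q * + N   ≤⟨ [n/ℕd]*d≤n (j - 1ℤ) N ⟩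
      j - 1ℤ    ≤⟨ ℤP.+-monoˡ-≤ -1ℤ j≤0 ⟩
      -1ℤ       <⟨ ℤ.-<+ ⟩
      0ℤ        ∎)

  h-pos : ∀ {j} → 0ℤ < j → 0ℤ < h n j
  h-pos {j} 0<j = ℤP.≰⇒> λ h≤0 → ℤP.<⇒≱ 0<j (begin
    j             ≤⟨ h-upper j ⟩
    h n j * + N   ≤⟨ ℤP.*-monoʳ-≤-nonNeg (+ N) h≤0 ⟩
    0ℤ            ∎)

  h-shift : ∀ j → h n (j + + N) ≡ h n j + 1ℤ
  h-shift j = begin-equality
    (j + + N - 1ℤ) /ℕ N + 1ℤ      ≡⟨ cong (λ x → x /ℕ N + 1ℤ) (reassoc j (+ N)) ⟩
    (j - 1ℤ + + N) /ℕ N + 1ℤ      ≡⟨ cong (_+ 1ℤ) (/ℕ-shift N (j - 1ℤ)) ⟩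
    ℤ.suc q + 1ℤ                  ≡⟨ cong (_+ 1ℤ) (ℤP.+-comm 1ℤ q) ⟩
    q + 1ℤ + 1ℤ                   ∎
    where
    q = (j - 1ℤ) /ℕ N
    reassoc : ∀ j N → j + N - 1ℤ ≡ j - 1ℤ + N
    reassoc = solve-∀

  h-zero : h n 0ℤ ≡ 0ℤ
  h-zero = cong (_+ 1ℤ) (/ℕ-unique N -1ℤ { -1ℤ} -N≤-1 ℤ.-<+)
    where
    -N≤-1 : -1ℤ * + N ≤ -1ℤ
    -N≤-1 = ℤP.≤-trans (ℤP.≤-reflexive (ℤP.-1*i≡-i (+ N))) (ℤ.-≤- z≤n)

  h-multiple : ∀ k → h n (+ (k ℕ.* N)) ≡ + k
  h-multiple zero    = h-zero
  h-multiple (suc k) = begin-equality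
    h n (+ N + + (k ℕ.* N))    ≡⟨ cong (h n) (ℤP.+-comm (+ N) (+ (k ℕ.* N))) ⟩
    h n (+ (k ℕ.* N) + + N)    ≡⟨ h-shift (+ (k ℕ.* N)) ⟩
    h n (+ (k ℕ.* N)) + 1ℤ     ≡⟨ cong (_+ 1ℤ) (h-multiple k) ⟩
    + (k ℕ.+ 1)                ≡⟨ cong +_ (ℕP.+-comm k 1) ⟩
    + suc k                    ∎

  -- lev j b unfolds to level j (WD b) (degree b).
  level : ℤ → ℕ → ℕ → ℤ
  level j W d = h n j * + W + + d - 1ℤ

  x<x+d-1 : ∀ x {d} → 2 ℕ.≤ d → x < x + + d - 1ℤ
  x<x+d-1 x {suc (suc e)} (s≤s (s≤s z≤n)) = begin-strict
    x                      ≡⟨ ℤP.+-identityʳ x ⟨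
    x + 0ℤ                 <⟨ ℤP.+-monoʳ-< x (ℤ.+<+ (s≤s z≤n)) ⟩
    x + + suc e            ≡⟨ drop-one x (+ e) ⟨
    x + + suc (suc e) - 1ℤ ∎
    where
    drop-one : ∀ x e → x + (1ℤ + (1ℤ + e)) - 1ℤ ≡ x + (1ℤ + e)
    drop-one = solve-∀

  level-zero : ∀ W d → level 0ℤ W d ≡ + d - 1ℤ
  level-zero W d = cong (λ A → A * + W + + d - 1ℤ) h-zero

  level-zero≤0⇒d≤1 : ∀ W d → level 0ℤ W d ≤ 0ℤ → d ℕ.≤ 1
  level-zero≤0⇒d≤1 W d p with d | subst (_≤ 0ℤ) (level-zero W d) p
  ... | zero        | _         = z≤n
  ... | suc zero    | _         = s≤s z≤n
  ... | suc (suc _) | ℤ.+≤+ ()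

  level-zero≰0⇒2≤d : ∀ W d → ¬ level 0ℤ W d ≤ 0ℤ → 2 ℕ.≤ d
  level-zero≰0⇒2≤d W (suc (suc _)) _ = s≤s (s≤s z≤n)
  level-zero≰0⇒2≤d W zero          p = ⊥-elim (p (subst (_≤ 0ℤ) (sym (level-zero W 0)) ℤ.-≤+))
  level-zero≰0⇒2≤d W (suc zero)    p = ⊥-elim (p (subst (_≤ 0ℤ) (sym (level-zero W 1)) ℤP.≤-refl))

  level-minus-one : ∀ W → level -1ℤ W 0 ≤ -1ℤ
  level-minus-one W = ℤP.+-monoˡ-≤ -1ℤ (begin
    h n -1ℤ * + W + 0ℤ   ≡⟨ ℤP.+-identityʳ _ ⟩
    h n -1ℤ * + W        ≤⟨ ℤP.*-monoʳ-≤-nonNeg (+ W) (h-nonpos ℤ.-≤+) ⟩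
    0ℤ                   ∎)

  level-shift : ∀ j {W D} d → W ℕ.+ D ≡ N → level (j + + N) W (d ℕ.+ D) ≡ level j W d + + N
  level-shift j {W} {D} d W+D≡N = begin-equality
    h n (j + + N) * + W + + (d ℕ.+ D) - 1ℤ   ≡⟨ cong (λ A → A * + W + + (d ℕ.+ D) - 1ℤ) (h-shift j) ⟩
    (h n j + 1ℤ) * + W + (+ d + + D) - 1ℤ    ≡⟨ regroup (h n j) (+ W) (+ d) (+ D) ⟩
    level j W d + (+ W + + D)                ≡⟨ cong (λ x → level j W d + + x) W+D≡N ⟩
    level j W d + + N                        ∎
    where
    regroup : ∀ A W d D → (A + 1ℤ) * W + (d + D) - 1ℤ ≡ A * W + d - 1ℤ + (W + D)
    regroup = solve-∀

  level-window : ∀ {j W d} → W ℕ.≤ N → N ℕ.≤ W ℕ.+ d → 2 ℕ.≤ d → j ≤ + N - + 2 → j < level j W d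
  level-window {j} {W} {d} W≤N N≤W+d 2≤d j≤N-2 with h n j ℤP.≤? 0ℤ
  ... | yes A≤0 = begin-strict
    j                   ≤⟨ h-upper j ⟩
    h n j * + N         ≤⟨ ℤP.*-monoˡ-≤-nonPos (h n j) {{ℤ.nonPositive A≤0}} (ℤ.+≤+ W≤N) ⟩
    h n j * + W         <⟨ x<x+d-1 (h n j * + W) 2≤d ⟩
    level j W d         ∎
  ... | no A≰0 = begin-strict
    j                   ≤⟨ j≤N-2 ⟩
    + N - + 2           <⟨ ℤP.+-monoʳ-< (+ N) (ℤ.-<- (s≤s z≤n)) ⟩
    + N - 1ℤ            ≤⟨ ℤP.+-monoˡ-≤ -1ℤ (ℤ.+≤+ N≤W+d) ⟩
    + W + + d - 1ℤ      ≤⟨ ℤP.+-monoˡ-≤ -1ℤ (ℤP.+-monoˡ-≤ (+ d) W≤AW) ⟩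
    level j W d         ∎
    where
    W≤AW : + W ≤ h n j * + W
    W≤AW = ℤP.≤-trans (ℤP.≤-reflexive (sym (ℤP.*-identityˡ (+ W))))
                      (ℤP.*-monoʳ-≤-nonNeg (+ W) (ℤP.i<j⇒suc[i]≤j (ℤP.≰⇒> A≰0)))

  level-crossing⇒W<N : ∀ {j W d} → 0ℤ < j → 2 ℕ.≤ d → level j W d ≤ j → W ℕ.< N
  level-crossing⇒W<N {j} {W} {d} 0<j 2≤d crossing =
    ℤP.drop‿+<+ (ℤP.*-cancelˡ-<-nonNeg (h n j) {{ℤ.nonNegative (ℤP.<⇒≤ (h-pos 0<j))}} (begin-strict
      h n j * + W    <⟨ x<x+d-1 (h n j * + W) 2≤d ⟩
      level j W d    ≤⟨ crossing ⟩
      j              ≤⟨ h-upper j ⟩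
      h n j * + N    ∎))

  level-multiple-≤ : ∀ k {W d} → m ℕ.≤ suc k → W ℕ.≤ m → d ℕ.≤ m → level (+ (k ℕ.* N)) W d ≤ + (k ℕ.* N)
  level-multiple-≤ k {W} {d} m≤1+k W≤m d≤m = begin
    h n (+ (k ℕ.* N)) * + W + + d - 1ℤ   ≡⟨ cong (λ A → A * + W + + d - 1ℤ) (h-multiple k) ⟩
    + k * + W + + d - 1ℤ                  ≡⟨ cong (λ x → x + + d - 1ℤ) (ℤP.pos-* k W) ⟨
    + (k ℕ.* W ℕ.+ d) - 1ℤ                ≤⟨ ℤP.+-monoˡ-≤ -1ℤ (ℤ.+≤+ kW+d≤1+kN) ⟩
    + (k ℕ.* N)                           ∎
    where
    kW+d≤1+kN : k ℕ.* W ℕ.+ d ℕ.≤ suc (k ℕ.* N)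
    kW+d≤1+kN = ℕP.≤-trans (ℕP.+-mono-≤ (ℕP.*-monoʳ-≤ k W≤m) (ℕP.≤-trans d≤m m≤1+k))
                           (ℕP.≤-reflexive (regroup k m))
      where
      regroup : ∀ k m → k ℕ.* m ℕ.+ suc k ≡ suc (k ℕ.* suc m)
      regroup = ℕ-Solver.solve-∀

  per-lev-shift : ∀ (b : Basis n) → WD b ℕ.≤ N → ∀ j → lev (j + + N) (per b) ≡ lev j b + + N
  per-lev-shift b WD≤N j = begin-equality
    level (j + + N) (WD (per b)) (degree (per b))          ≡⟨ cong₂ (level (j + + N)) (WD-per b) (degree-per b) ⟩
    level (j + + N) (WD b) (degree b ℕ.+ (N ℕ.∸ WD b))   ≡⟨ level-shift j (degree b) (ℕP.m+[n∸m]≡n WD≤N) ⟩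
    level j (WD b) (degree b) + + N                        ∎

  per-no-early-crossing : ∀ (b : Basis n) → WD b ℕ.≤ N → 2 ℕ.≤ degree (per b) → ¬ 𝓝 (+ N - + 2) (per b)
  per-no-early-crossing b WD≤N 2≤deg (j , _ , j≤N-2 , crossing) =
    ℤP.<⇒≱ (level-window W≤N N≤W+d 2≤deg j≤N-2) crossing
    where
    W≤N : WD (per b) ℕ.≤ N
    W≤N = subst (ℕ._≤ N) (sym (WD-per b)) WD≤N
    N≤W+d : N ℕ.≤ WD (per b) ℕ.+ degree (per b)
    N≤W+d = subst₂ ℕ._≤_ (ℕP.m+[n∸m]≡n WD≤N) (cong₂ ℕ._+_ (sym (WD-per b)) (sym (degree-per b)))
              (ℕP.+-monoʳ-≤ (WD b) (ℕP.m≤n+m (N ℕ.∸ WD b) (degree b)))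

  𝓛₀-degree : ∀ (b : Basis n) → 𝓛 0 b → degree b ≡ 1
  𝓛₀-degree b 𝓛b@(_ , ¬𝓝b) =
    ℕP.≤-antisym (level-zero≤0⇒d≤1 (WD b) (degree b) (𝓛-crossing 0 b 𝓛b)) (ℕP.n≢0⇒n>0 deg≢0)
    where
    deg≢0 : degree b ≢ 0
    deg≢0 deg≡0 = ¬𝓝b (-1ℤ , ℤP.≤-refl , ℤP.≤-refl ,
      subst (λ d → level -1ℤ (WD b) d ≤ -1ℤ) (sym deg≡0) (level-minus-one (WD b)))

  𝓛⁺-bounds : ∀ i (b : Basis n) → 𝓛 (suc i) b → 2 ℕ.≤ degree b × WD b ℕ.< N
  𝓛⁺-bounds i b 𝓛b@(_ , ¬𝓝b) =
    2≤deg , level-crossing⇒W<N (ℤ.+<+ (s≤s z≤n)) 2≤deg (𝓛-crossing (suc i) b 𝓛b)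
    where
    2≤deg : 2 ℕ.≤ degree b
    2≤deg = level-zero≰0⇒2≤d (WD b) (degree b) (λ crossing₀ → ¬𝓝b (0ℤ , ℤ.-≤+ , ℤ.+≤+ z≤n , crossing₀))

  𝓛⇒per-bounds : ∀ i (b : Basis n) → 𝓛 i b → WD b ℕ.≤ N × 2 ℕ.≤ degree (per b)
  𝓛⇒per-bounds zero b 𝓛b = ℕP.m≤n⇒m≤1+n WD≤m , ℕP.≤-trans 2≤1+D (ℕP.≤-reflexive (sym deg-per≡1+D))
    where
    WD≤m : WD b ℕ.≤ m
    WD≤m = degree-one⇒WD≤ b (𝓛₀-degree b 𝓛b)
    2≤1+D : 2 ℕ.≤ 1 ℕ.+ (N ℕ.∸ WD b)
    2≤1+D = s≤s (ℕP.m<n⇒0<n∸m (s≤s WD≤m))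
    deg-per≡1+D : degree (per b) ≡ 1 ℕ.+ (N ℕ.∸ WD b)
    deg-per≡1+D = trans (degree-per b) (cong (ℕ._+ (N ℕ.∸ WD b)) (𝓛₀-degree b 𝓛b))
  𝓛⇒per-bounds (suc i) b 𝓛b with 𝓛⁺-bounds i b 𝓛b
  ... | 2≤deg , WD<N =
    ℕP.<⇒≤ WD<N , ℕP.≤-trans 2≤deg (ℕP.≤-trans (ℕP.m≤m+n _ _) (ℕP.≤-reflexive (sym (degree-per b))))

  per-preserves-𝓛 : ∀ i (b : Basis n) → 𝓛 i b → 𝓛 (i ℕ.+ N) (per b)
  per-preserves-𝓛 i b 𝓛b with 𝓛⇒per-bounds i b 𝓛b
  ... | WD≤N , 2≤deg = 𝓛-shift N {b} {per b} (per-lev-shift b WD≤N) (per-no-early-crossing b WD≤N 2≤deg) 𝓛b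

  -- The crossing index (n-3)N lies in the range -1 ≤ j ≤ i + N - 1 excluded by c ∈ 𝓛_{i+N}.
  𝓛-degree-large : ∀ {i} → (m ℕ.∸ 1) ℕ.* N ℕ.≤ i ℕ.+ m → (c : Basis n) →
                   WD c ℕ.< N → 𝓛 (i ℕ.+ N) c → N ℕ.≤ degree c
  𝓛-degree-large {i} bound c WD<N (_ , ¬𝓝c) with N ℕ.≤? degree c
  ... | yes N≤deg = N≤deg
  ... | no  N≰deg = ⊥-elim (¬𝓝c (+ j₀ , ℤ.-≤+ , j₀≤i+N-1 ,
                      level-multiple-≤ (m ℕ.∸ 1) (ℕP.m≤n+m∸n m 1) (ℕ.s≤s⁻¹ WD<N) (ℕ.s≤s⁻¹ (ℕP.≰⇒> N≰deg))))
    where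
    j₀ = (m ℕ.∸ 1) ℕ.* N
    j₀≤i+N-1 : + j₀ ≤ + (i ℕ.+ N) - 1ℤ
    j₀≤i+N-1 = subst (+ j₀ ≤_) (cong (λ x → + x - 1ℤ) (sym (ℕP.+-suc i m))) (ℤ.+≤+ bound)

  per-onto-𝓛 : ∀ {i} → (m ℕ.∸ 1) ℕ.* N ℕ.≤ i ℕ.+ m →
               (c : Basis n) → 𝓛 (i ℕ.+ N) c → ∃ λ (b : Basis n) → 𝓛 i b × per b ≡ c
  per-onto-𝓛 {i} bound c 𝓛c =
    unper c ,
    𝓛-unshift N {unper c} {per (unper c)} (per-lev-shift (unper c) WD≤N)
      (subst (𝓛 (i ℕ.+ N)) (sym per-unper-c) 𝓛c) ,
    per-unper-c
    where
    WD<N : WD c ℕ.< N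
    WD<N = proj₂ (𝓛⁺-bounds (i ℕ.+ m) c (subst (λ x → 𝓛 x c) (ℕP.+-suc i m) 𝓛c))
    per-unper-c : per (unper c) ≡ c
    per-unper-c = per-unper c (𝓛-degree-large bound c WD<N 𝓛c)
    WD≤N : WD (unper c) ℕ.≤ N
    WD≤N = subst (ℕ._≤ N) (trans (sym (cong WD per-unper-c)) (WD-per (unper c))) (ℕP.<⇒≤ WD<N)

large-index-bound : ∀ m i → (+ suc (suc m) - + 4) * (+ suc (suc m) - + 1) < + i →
                    (m ℕ.∸ 1) ℕ.* suc m ℕ.≤ i ℕ.+ m
large-index-bound zero          i _ = z≤n
large-index-bound (suc zero)    i _ = z≤n
large-index-bound (suc (suc k)) i i-large with subst (_< + i) (sym (ℤP.pos-* k (3 ℕ.+ k))) i-large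
... | ℤ.+<+ k[3+k]<i = begin
  suc k ℕ.* (3 ℕ.+ k)                    ≡⟨ regroup k ⟩
  (2 ℕ.+ k) ℕ.+ suc (k ℕ.* (3 ℕ.+ k))    ≤⟨ ℕP.+-monoʳ-≤ (2 ℕ.+ k) k[3+k]<i ⟩
  (2 ℕ.+ k) ℕ.+ i                        ≡⟨ ℕP.+-comm (2 ℕ.+ k) i ⟩
  i ℕ.+ (2 ℕ.+ k)                        ∎
  where
  open ℕP.≤-Reasoning
  regroup : ∀ k → suc k ℕ.* (3 ℕ.+ k) ≡ (2 ℕ.+ k) ℕ.+ suc (k ℕ.* (3 ℕ.+ k))
  regroup = ℕ-Solver.solve-∀

corollary2p17 : (n : ℕ) → 2 ℕ.≤ n → (i : ℕ) →
    (+ n ℤ.- + 4) ℤ.* (+ n ℤ.- + 1) ℤ.< + i →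
    ((b : Basis n) → 𝓛 i b → 𝓛 (i ℕ.+ (n ℕ.∸ 1)) (per b))
    × ((b b′ : Basis n) → 𝓛 i b → 𝓛 i b′ → per b ≡ per b′ → b ≡ b′)
    × ((c : Basis n) → 𝓛 (i ℕ.+ (n ℕ.∸ 1)) c → ∃ λ (b : Basis n) → 𝓛 i b × per b ≡ c)
corollary2p17 zero          ()
corollary2p17 (suc zero)    (s≤s ())
corollary2p17 (suc (suc m)) _ i i-large =
  per-preserves-𝓛 i , (λ _ _ _ _ → per-injective) , per-onto-𝓛 (large-index-bound m i i-large)
  where open Period m
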